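{- Let $D$ be a finite digraph and let $Q\subseteq V(D)$ be a quasikernel with $|N^+[Q]|=\varepsilon|V(D)|$ for some $0<\varepsilon<1$. Then there exists a $3$-kernel $Q'\subseteq V(D)$ with $|N^+[Q']|\ge\frac{1-\varepsilon}{2}|V(D)|$.
   Context: A set is independent if there are no arcs between two of its vertices. $\mathrm{dist}(S,v)$ is the minimum over $u\in S$ of the length of a shortest directed path from $u$ to $v$. A $q$-kernel is an independent set $Q$ with $\mathrm{dist}(Q,v)\le q$ for all $v\in V(D)$; a quasikernel is a $2$-kernel. For $S\subseteq V(D)$, $N^+[S]=S\cup\{v:\exists u\in S,\ uv\in E(D)\}$. -}

module Defs where

open import Data.Nat using (ℕ; zero; suc; _≤_)
open import Data.Fin using (Fin)
open import Data.Bool using (Bool; true; false; _∧_; _∨_; T)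
open import Data.Vec using (tabulate; lookup)
open import Data.Fin.Subset using (Subset; _∈_; ∣_∣)
open import Data.Product using (Σ; ∃; ∃-syntax; _×_; _,_)
open import Data.Empty using (⊥)
open import Relation.Nullary using (¬_)
open import Relation.Binary.PropositionalEquality using (_≡_)

record Digraph (n : ℕ) : Set where
  field
    arc      : Fin n → Fin n → Bool
    loopless : ∀ v → arc v v ≡ false
open Digraph public

module _ {n : ℕ} (D : Digraph n) where

  Arc : Fin n → Fin n → Set
  Arc u v = T (arc D u v)

  data Walk : Fin n → Fin n → ℕ → Set where
    here : ∀ {v} → Walk v v 0
    step : ∀ {u w v k} → Arc u w → Walk w v k → Walk u v (suc k)

  Independent : Subset n → Set
  Independent S = ∀ u v → u ∈ S → v ∈ S → ¬ Arc u v

  -- dist(S, v) ≤ q : some u ∈ S reaches v by a directed path of length ≤ q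
  -- (equivalently a directed walk; the shortest walk is a path).
  DistLe : Subset n → Fin n → ℕ → Set
  DistLe S v q = ∃[ u ] ∃[ k ] (u ∈ S × k ≤ q × Walk u v k)

  IsQKernel : ℕ → Subset n → Set
  IsQKernel q Q = Independent Q × (∀ v → DistLe Q v q)

  IsQuasikernel : Subset n → Set
  IsQuasikernel = IsQKernel 2

anyFin : ∀ {m} → (Fin m → Bool) → Bool
anyFin {zero}  f = false
anyFin {suc m} f = f Fin.zero ∨ anyFin (λ i → f (Fin.suc i))

N⁺[_]_ : ∀ {n} → Subset n → Digraph n → Subset n
N⁺[ S ] D = tabulate (λ v → lookup S v ∨ anyFin (λ u → lookup S u ∧ arc D u v))

-- Let R be the set of vertices outside N⁺[Q]. Inside the subdigraph induced by R pick a
-- vertex v with in-degree at most out-degree (one exists because in- and out-degrees have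
-- equal sums), put v into S and delete v together with its in- and out-neighbours. A round
-- deletes at most 1 + 2·outdeg(v) vertices of R and covers 1 + outdeg(v) of them by N⁺[S],
-- so the resulting independent S ⊆ R satisfies |R| ≤ 2|R ∩ N⁺[S]|. Then
-- Q′ = S ∪ (Q ∖ N⁺[S]) is independent, since no arc joins Q to S (S avoids N⁺[Q]), and is a
-- 3-kernel, since a vertex of Q dropped because of an arc from S is replaced by that
-- in-neighbour, one step further back. Finally |V| = |N⁺[Q]| + |R| ≤ ε|V| + 2|N⁺[Q′]|.

module Submission where

open import Defs
open import Data.Nat using (ℕ)
open import Data.Integer using (+_)
open import Data.Rational using (ℚ; 0ℚ; 1ℚ; ½; _<_; _≤_; _*_; _-_; _/_)
open import Data.Fin.Subset using (Subset; ∣_∣)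
open import Data.Product using (Σ; ∃; ∃-syntax; _×_; _,_)
open import Relation.Binary.PropositionalEquality using (_≡_)

open import Data.Bool using (Bool; true; false; T; _∧_; _∨_; if_then_else_)
open import Data.Bool.Properties using (T-≡; T-∧; T-∨)
open import Data.Empty using (⊥-elim)
open import Data.Fin using (Fin; zero; suc)
open import Data.Fin.Properties using (any?)
open import Data.Fin.Subset using (_∈_; _∉_; _⊆_; _∪_; _∩_; _─_; ∁; ⁅_⁆; Nonempty; Empty)
  renaming (⊥ to ∅)
open import Data.Fin.Subset.Properties
  using ( _∈?_; nonempty?; Empty-unique; ∉⊥; ⊥⊆; x∈⁅x⁆; x∈⁅y⁆⇒x≡y; x∈∁p⇒x∉p
        ; x∈p∩q⁺; x∈p∩q⁻; x∈p∪q⁺; x∈p∪q⁻; p⊆p∪q; q⊆p∪q; p─q⊆p; x∈p∧x∉q⇒x∈p─q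
        ; ∣p∣≤n; ∣⊥∣≡0; ∣⁅x⁆∣≡1; ∣∁p∣≡n∸∣p∣; p⊆q⇒∣p∣≤∣q∣; p∩q≢∅⇒∣p─q∣<∣p∣ )
import Data.Integer as ℤ
import Data.Integer.Properties as ℤ
open import Data.Nat as ℕ using (_+_) renaming (_≤_ to _≤ℕ_; _<_ to _<ℕ_)
open import Data.Nat.Coprimality as Coprime using (1-coprimeTo)
open import Data.Nat.Induction using (<-wellFounded)
import Data.Nat.Properties as ℕ
open import Data.Nat.Tactic.RingSolver using (solve-∀)
open import Algebra.Properties.CommutativeMonoid.Sum ℕ.+-0-commutativeMonoid
  using (sum; sum-syntax; sum-cong-≗; ∑-comm)
open import Data.Product using (proj₁; proj₂)
import Data.Rational as ℚ
import Data.Rational.Properties as ℚ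
open import Data.Rational.Solver using (module +-*-Solver)
open import Data.Sum using (_⊎_; inj₁; inj₂)
open import Data.Vec using (_∷_; []; lookup; tabulate; here; there)
open import Data.Vec.Properties using (lookup∘tabulate; []=⇒lookup; lookup⇒[]=)
open import Function using (_∘_; _⇔_; mk⇔; Equivalence)
open import Function.Properties.Equivalence using () renaming (trans to ⇔-trans)
open import Induction.WellFounded using (module All)
import Relation.Binary.Construct.On as On
open import Relation.Binary.PropositionalEquality
  using (refl; sym; trans; cong; cong₂; subst; subst₂; module ≡-Reasoning)
open import Relation.Nullary using (¬_; yes; no)
open import Relation.Nullary.Decidable using (_×-dec_)

open Equivalence using (to; from)

1+[o+i]+2x≤2[1+o+x] : ∀ {o i} x → i ≤ℕ o → 1 + (o + i) + 2 ℕ.* x ≤ℕ 2 ℕ.* (1 + (o + x))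
1+[o+i]+2x≤2[1+o+x] {o} {i} x i≤o = begin
  1 + (o + i) + 2 ℕ.* x        ≤⟨ ℕ.+-monoˡ-≤ (2 ℕ.* x) (ℕ.s≤s (ℕ.+-monoʳ-≤ o i≤o)) ⟩
  1 + (o + o) + 2 ℕ.* x        ≤⟨ ℕ.n≤1+n _ ⟩
  1 + (1 + (o + o) + 2 ℕ.* x)  ≡⟨ lemma o x ⟩
  2 ℕ.* (1 + (o + x))          ∎
  where
  open ℕ.≤-Reasoning
  lemma : ∀ o x → 1 + (1 + (o + o) + 2 ℕ.* x) ≡ 2 ℕ.* (1 + (o + x))
  lemma = solve-∀

∑-mono-≤ : ∀ {n} {f g : Fin n → ℕ} → (∀ i → f i ≤ℕ g i) → sum f ≤ℕ sum g
∑-mono-≤ {ℕ.zero}  f≤g = ℕ.z≤n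
∑-mono-≤ {ℕ.suc n} f≤g = ℕ.+-mono-≤ (f≤g zero) (∑-mono-≤ (f≤g ∘ suc))

∑-mono-< : ∀ {n} {f g : Fin n → ℕ} → (∀ i → f i ≤ℕ g i) → ∀ j → f j <ℕ g j → sum f <ℕ sum g
∑-mono-< f≤g zero    f<g = ℕ.+-mono-<-≤ f<g (∑-mono-≤ (f≤g ∘ suc))
∑-mono-< f≤g (suc j) f<g = ℕ.+-mono-≤-< (f≤g zero) (∑-mono-< (f≤g ∘ suc) j f<g)

∣p∪q∣+∣p∩q∣≡∣p∣+∣q∣ : ∀ {n} (p q : Subset n) → ∣ p ∪ q ∣ + ∣ p ∩ q ∣ ≡ ∣ p ∣ + ∣ q ∣
∣p∪q∣+∣p∩q∣≡∣p∣+∣q∣ [] [] = refl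
∣p∪q∣+∣p∩q∣≡∣p∣+∣q∣ (true ∷ p) (true ∷ q) =
  cong ℕ.suc (trans (ℕ.+-suc _ _) (trans (cong ℕ.suc (∣p∪q∣+∣p∩q∣≡∣p∣+∣q∣ p q)) (sym (ℕ.+-suc _ _))))
∣p∪q∣+∣p∩q∣≡∣p∣+∣q∣ (true ∷ p) (false ∷ q) = cong ℕ.suc (∣p∪q∣+∣p∩q∣≡∣p∣+∣q∣ p q)
∣p∪q∣+∣p∩q∣≡∣p∣+∣q∣ (false ∷ p) (true ∷ q) =
  trans (cong ℕ.suc (∣p∪q∣+∣p∩q∣≡∣p∣+∣q∣ p q)) (sym (ℕ.+-suc _ _))
∣p∪q∣+∣p∩q∣≡∣p∣+∣q∣ (false ∷ p) (false ∷ q) = ∣p∪q∣+∣p∩q∣≡∣p∣+∣q∣ p q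

∣p∪q∣≤∣p∣+∣q∣ : ∀ {n} (p q : Subset n) → ∣ p ∪ q ∣ ≤ℕ ∣ p ∣ + ∣ q ∣
∣p∪q∣≤∣p∣+∣q∣ p q = subst (∣ p ∪ q ∣ ≤ℕ_) (∣p∪q∣+∣p∩q∣≡∣p∣+∣q∣ p q) (ℕ.m≤m+n _ _)

disjoint⇒∣p∪q∣≡∣p∣+∣q∣ : ∀ {n} {p q : Subset n} → (∀ {x} → x ∈ p → x ∉ q) →
  ∣ p ∪ q ∣ ≡ ∣ p ∣ + ∣ q ∣
disjoint⇒∣p∪q∣≡∣p∣+∣q∣ {n} {p} {q} p∩q=∅ = begin
  ∣ p ∪ q ∣          ≡⟨ ℕ.+-identityʳ _ ⟨
  ∣ p ∪ q ∣ + 0      ≡⟨ cong (λ k → ∣ p ∪ q ∣ + k) (∣⊥∣≡0 n) ⟨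
  ∣ p ∪ q ∣ + ∣ ∅ {n} ∣  ≡⟨ cong (λ r → ∣ p ∪ q ∣ + ∣ r ∣) (Empty-unique empty) ⟨
  ∣ p ∪ q ∣ + ∣ p ∩ q ∣  ≡⟨ ∣p∪q∣+∣p∩q∣≡∣p∣+∣q∣ p q ⟩
  ∣ p ∣ + ∣ q ∣      ∎
  where
  open ≡-Reasoning
  empty : Empty (p ∩ q)
  empty (x , x∈p∩q) = let x∈p , x∈q = x∈p∩q⁻ p q x∈p∩q in p∩q=∅ x∈p x∈q

∣p∣+∣∁p∣≡n : ∀ {n} (p : Subset n) → ∣ p ∣ + ∣ ∁ p ∣ ≡ n
∣p∣+∣∁p∣≡n p = trans (cong (λ k → ∣ p ∣ + k) (∣∁p∣≡n∸∣p∣ p)) (ℕ.m+[n∸m]≡n (∣p∣≤n p))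

∣p∣≤∣q∣+∣p─q∣ : ∀ {n} (p q : Subset n) → ∣ p ∣ ≤ℕ ∣ q ∣ + ∣ p ─ q ∣
∣p∣≤∣q∣+∣p─q∣ p q = ℕ.≤-trans (p⊆q⇒∣p∣≤∣q∣ p⊆q∪[p─q]) (∣p∪q∣≤∣p∣+∣q∣ q (p ─ q))
  where
  p⊆q∪[p─q] : p ⊆ q ∪ (p ─ q)
  p⊆q∪[p─q] {x} x∈p with x ∈? q
  ... | yes x∈q = x∈p∪q⁺ (inj₁ x∈q)
  ... | no  x∉q = x∈p∪q⁺ (inj₂ (x∈p∧x∉q⇒x∈p─q x∈p x∉q))

x∈p─q⇒x∉q : ∀ {n} {p q : Subset n} {x} → x ∈ p ─ q → x ∉ q
x∈p─q⇒x∉q {p = _ ∷ p} {q = false ∷ q} here          ()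
x∈p─q⇒x∉q {p = _ ∷ p} {q = _ ∷ q}     (there x∈p─q) (there x∈q) = x∈p─q⇒x∉q x∈p─q x∈q

x∈p⇔T[p[x]] : ∀ {n} {p : Subset n} {x} → x ∈ p ⇔ T (lookup p x)
x∈p⇔T[p[x]] {p = p} {x} = mk⇔ (λ x∈p → from T-≡ ([]=⇒lookup x∈p)) (λ t → lookup⇒[]= x p (to T-≡ t))

x∈tabulate⇔ : ∀ {n} {f : Fin n → Bool} {x} → x ∈ tabulate f ⇔ T (f x)
x∈tabulate⇔ {f = f} {x} = subst (λ b → x ∈ tabulate f ⇔ T b) (lookup∘tabulate f x) x∈p⇔T[p[x]]

∣tabulate∣≡∑ : ∀ {n} (f : Fin n → Bool) → ∣ tabulate f ∣ ≡ ∑[ i < n ] (if f i then 1 else 0)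
∣tabulate∣≡∑ {ℕ.zero}  f = refl
∣tabulate∣≡∑ {ℕ.suc n} f with f zero
... | true  = cong ℕ.suc (∣tabulate∣≡∑ (f ∘ suc))
... | false = ∣tabulate∣≡∑ (f ∘ suc)

∑∣rows∣≡∑∣columns∣ : ∀ {m n} (M : Fin m → Fin n → Bool) →
  ∑[ i < m ] ∣ tabulate (M i) ∣ ≡ ∑[ j < n ] ∣ tabulate (λ i → M i j) ∣
∑∣rows∣≡∑∣columns∣ {m} {n} M = begin
  ∑[ i < m ] ∣ tabulate (M i) ∣                       ≡⟨ sum-cong-≗ (∣tabulate∣≡∑ ∘ M) ⟩
  ∑[ i < m ] ∑[ j < n ] (if M i j then 1 else 0)   ≡⟨ ∑-comm (λ i j → if M i j then 1 else 0) ⟩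
  ∑[ j < n ] ∑[ i < m ] (if M i j then 1 else 0)   ≡⟨ sum-cong-≗ (λ j → ∣tabulate∣≡∑ (λ i → M i j)) ⟨
  ∑[ j < n ] ∣ tabulate (λ i → M i j) ∣            ∎
  where open ≡-Reasoning

T-anyFin : ∀ {m} {f : Fin m → Bool} → T (anyFin f) ⇔ ∃ λ i → T (f i)
T-anyFin = mk⇔ witness (λ (i , fi) → any-intro i fi)
  where
  witness : ∀ {m} {f : Fin m → Bool} → T (anyFin f) → ∃ λ i → T (f i)
  witness {ℕ.suc m} {f} t with to (T-∨ {f zero}) t
  ... | inj₁ f0 = zero , f0
  ... | inj₂ rest = let i , fi = witness rest in suc i , fi
  any-intro : ∀ {m} {f : Fin m → Bool} i → T (f i) → T (anyFin f)
  any-intro {f = f} zero    fi = from (T-∨ {f zero}) (inj₁ fi)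
  any-intro {f = f} (suc i) fi = from (T-∨ {f zero}) (inj₂ (any-intro i fi))

module _ {n : ℕ} (D : Digraph n) where

  ¬Arc-loop : ∀ v → ¬ Arc D v v
  ¬Arc-loop v = subst T (loopless D v)

  x∈N⁺[S]⇔ : ∀ {S x} → x ∈ N⁺[ S ] D ⇔ (x ∈ S ⊎ ∃[ u ] (u ∈ S × Arc D u x))
  x∈N⁺[S]⇔ {S} {x} = mk⇔ ⇒ ⇐
    where
    ⇒ : x ∈ N⁺[ S ] D → x ∈ S ⊎ ∃[ u ] (u ∈ S × Arc D u x)
    ⇒ x∈N⁺ with to (T-∨ {lookup S x}) (to x∈tabulate⇔ x∈N⁺)
    ... | inj₁ x∈S = inj₁ (from x∈p⇔T[p[x]] x∈S)
    ... | inj₂ arcIn with to T-anyFin arcIn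
    ...   | u , u∈S∧ux = let u∈S , ux = to T-∧ u∈S∧ux in inj₂ (u , from x∈p⇔T[p[x]] u∈S , ux)
    ⇐ : x ∈ S ⊎ ∃[ u ] (u ∈ S × Arc D u x) → x ∈ N⁺[ S ] D
    ⇐ (inj₁ x∈S) = from x∈tabulate⇔ (from (T-∨ {lookup S x}) (inj₁ (to x∈p⇔T[p[x]] x∈S)))
    ⇐ (inj₂ (u , u∈S , ux)) = from x∈tabulate⇔ (from (T-∨ {lookup S x})
      (inj₂ (from T-anyFin (u , from T-∧ (to x∈p⇔T[p[x]] u∈S , ux)))))

  N⁺-mono : ∀ {S S′} → S ⊆ S′ → N⁺[ S ] D ⊆ N⁺[ S′ ] D
  N⁺-mono S⊆S′ x∈N⁺ with to x∈N⁺[S]⇔ x∈N⁺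
  ... | inj₁ x∈S = from x∈N⁺[S]⇔ (inj₁ (S⊆S′ x∈S))
  ... | inj₂ (u , u∈S , ux) = from x∈N⁺[S]⇔ (inj₂ (u , S⊆S′ u∈S , ux))

  arcWithin : Subset n → Fin n → Fin n → Bool
  arcWithin R u x = lookup R u ∧ lookup R x ∧ arc D u x

  T-arcWithin⇔ : ∀ {R u x} → T (arcWithin R u x) ⇔ (u ∈ R × x ∈ R × Arc D u x)
  T-arcWithin⇔ {R} {u} {x} = mk⇔
    (λ t → let u∈R , rest = to (T-∧ {lookup R u}) t ; x∈R , ux = to (T-∧ {lookup R x}) rest
           in from x∈p⇔T[p[x]] u∈R , from x∈p⇔T[p[x]] x∈R , ux)
    (λ (u∈R , x∈R , ux) → from (T-∧ {lookup R u}) (to x∈p⇔T[p[x]] u∈R ,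
                           from (T-∧ {lookup R x}) (to x∈p⇔T[p[x]] x∈R , ux)))

  outNbhd inNbhd : Subset n → Fin n → Subset n
  outNbhd R v = tabulate (arcWithin R v)
  inNbhd  R v = tabulate (λ u → arcWithin R u v)

  x∈outNbhd⇔ : ∀ {R v x} → x ∈ outNbhd R v ⇔ (v ∈ R × x ∈ R × Arc D v x)
  x∈outNbhd⇔ = ⇔-trans x∈tabulate⇔ T-arcWithin⇔

  x∈inNbhd⇔ : ∀ {R v x} → x ∈ inNbhd R v ⇔ (x ∈ R × v ∈ R × Arc D x v)
  x∈inNbhd⇔ = ⇔-trans x∈tabulate⇔ T-arcWithin⇔

  ∑∣outNbhd∣≡∑∣inNbhd∣ : ∀ R → sum (λ v → ∣ outNbhd R v ∣) ≡ sum (λ v → ∣ inNbhd R v ∣)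
  ∑∣outNbhd∣≡∑∣inNbhd∣ R = ∑∣rows∣≡∑∣columns∣ (arcWithin R)

  ∃in≤out : ∀ {R} → Nonempty R → ∃[ v ] (v ∈ R × ∣ inNbhd R v ∣ ≤ℕ ∣ outNbhd R v ∣)
  ∃in≤out {R} (w , w∈R) with any? (λ v → v ∈? R ×-dec ∣ inNbhd R v ∣ ℕ.≤? ∣ outNbhd R v ∣)
  ... | yes found = found
  ... | no  none  = ⊥-elim (ℕ.<-irrefl (∑∣outNbhd∣≡∑∣inNbhd∣ R) (∑-mono-< out≤in w (out<in w∈R)))
    where
    out<in : ∀ {v} → v ∈ R → ∣ outNbhd R v ∣ <ℕ ∣ inNbhd R v ∣
    out<in v∈R = ℕ.≰⇒> (λ in≤out → none (_ , v∈R , in≤out))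
    out≤in : ∀ v → ∣ outNbhd R v ∣ ≤ℕ ∣ inNbhd R v ∣
    out≤in v with v ∈? R
    ... | yes v∈R = ℕ.<⇒≤ (out<in v∈R)
    ... | no  v∉R = p⊆q⇒∣p∣≤∣q∣ {q = inNbhd R v} (λ x∈out → ⊥-elim (v∉R (proj₁ (to x∈outNbhd⇔ x∈out))))

  block : Subset n → Fin n → Subset n
  block R v = ⁅ v ⁆ ∪ outNbhd R v ∪ inNbhd R v

  v∈block : ∀ R v → v ∈ block R v
  v∈block R v = x∈p∪q⁺ (inj₁ (x∈⁅x⁆ v))

  ∣block∣≤1+out+in : ∀ R v → ∣ block R v ∣ ≤ℕ 1 + (∣ outNbhd R v ∣ + ∣ inNbhd R v ∣)
  ∣block∣≤1+out+in R v = ℕ.≤-trans (∣p∪q∣≤∣p∣+∣q∣ ⁅ v ⁆ _)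
    (ℕ.+-mono-≤ (ℕ.≤-reflexive (∣⁅x⁆∣≡1 v)) (∣p∪q∣≤∣p∣+∣q∣ (outNbhd R v) (inNbhd R v)))

  IndependentHalfCover : Subset n → Subset n → Set
  IndependentHalfCover R S = S ⊆ R × Independent D S × ∣ R ∣ ≤ℕ 2 ℕ.* ∣ R ∩ N⁺[ S ] D ∣

  module _ {R : Subset n} {v : Fin n} (v∈R : v ∈ R) where

    private
      R′ = R ─ block R v

    ⁅v⁆∪-independent : ∀ {S′} → S′ ⊆ R′ → Independent D S′ → Independent D (⁅ v ⁆ ∪ S′)
    ⁅v⁆∪-independent {S′} S′⊆R′ S′-ind a b a∈S b∈S ab
      with x∈p∪q⁻ ⁅ v ⁆ S′ a∈S | x∈p∪q⁻ ⁅ v ⁆ S′ b∈S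
    ... | inj₁ a∈⁅v⁆ | inj₁ b∈⁅v⁆ rewrite x∈⁅y⁆⇒x≡y v a∈⁅v⁆ | x∈⁅y⁆⇒x≡y v b∈⁅v⁆ = ¬Arc-loop v ab
    ... | inj₁ a∈⁅v⁆ | inj₂ b∈S′ rewrite x∈⁅y⁆⇒x≡y v a∈⁅v⁆ =
      x∈p─q⇒x∉q (S′⊆R′ b∈S′)
        (x∈p∪q⁺ (inj₂ (x∈p∪q⁺ (inj₁ (from x∈outNbhd⇔ (v∈R , p─q⊆p R _ (S′⊆R′ b∈S′) , ab))))))
    ... | inj₂ a∈S′ | inj₁ b∈⁅v⁆ rewrite x∈⁅y⁆⇒x≡y v b∈⁅v⁆ =
      x∈p─q⇒x∉q (S′⊆R′ a∈S′)
        (x∈p∪q⁺ (inj₂ (x∈p∪q⁺ (inj₂ (from x∈inNbhd⇔ (p─q⊆p R _ (S′⊆R′ a∈S′) , v∈R , ab))))))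
    ... | inj₂ a∈S′ | inj₂ b∈S′ = S′-ind a b a∈S′ b∈S′ ab

    1+out+covered≤covered : ∀ S′ →
      1 + (∣ outNbhd R v ∣ + ∣ R′ ∩ N⁺[ S′ ] D ∣) ≤ℕ ∣ R ∩ N⁺[ ⁅ v ⁆ ∪ S′ ] D ∣
    1+out+covered≤covered S′ = begin
      1 + (∣ O ∣ + ∣ X ∣)   ≡⟨ cong₂ _+_ (∣⁅x⁆∣≡1 v) (disjoint⇒∣p∪q∣≡∣p∣+∣q∣ O∩X=∅) ⟨
      ∣ ⁅ v ⁆ ∣ + ∣ O ∪ X ∣ ≡⟨ disjoint⇒∣p∪q∣≡∣p∣+∣q∣ v∉O∪X ⟨
      ∣ ⁅ v ⁆ ∪ O ∪ X ∣     ≤⟨ p⊆q⇒∣p∣≤∣q∣ ⁅v⁆∪O∪X⊆ ⟩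
      ∣ R ∩ N⁺[ S ] D ∣     ∎
      where
      open ℕ.≤-Reasoning
      S = ⁅ v ⁆ ∪ S′
      O = outNbhd R v
      X = R′ ∩ N⁺[ S′ ] D
      O⊆block : O ⊆ block R v
      O⊆block x∈O = x∈p∪q⁺ (inj₂ (x∈p∪q⁺ (inj₁ x∈O)))
      O∩X=∅ : ∀ {x} → x ∈ O → x ∉ X
      O∩X=∅ x∈O x∈X = x∈p─q⇒x∉q (proj₁ (x∈p∩q⁻ R′ _ x∈X)) (O⊆block x∈O)
      v∉O∪X : ∀ {x} → x ∈ ⁅ v ⁆ → x ∉ O ∪ X
      v∉O∪X x∈⁅v⁆ x∈O∪X rewrite x∈⁅y⁆⇒x≡y v x∈⁅v⁆ with x∈p∪q⁻ O X x∈O∪X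
      ... | inj₁ v∈O = ¬Arc-loop v (proj₂ (proj₂ (to (x∈outNbhd⇔ {R}) v∈O)))
      ... | inj₂ v∈X = x∈p─q⇒x∉q (proj₁ (x∈p∩q⁻ R′ _ v∈X)) (v∈block R v)
      v∈S : v ∈ S
      v∈S = x∈p∪q⁺ (inj₁ (x∈⁅x⁆ v))
      ⁅v⁆∪O∪X⊆ : ⁅ v ⁆ ∪ O ∪ X ⊆ R ∩ N⁺[ S ] D
      ⁅v⁆∪O∪X⊆ x∈ with x∈p∪q⁻ ⁅ v ⁆ (O ∪ X) x∈
      ... | inj₁ x∈⁅v⁆ rewrite x∈⁅y⁆⇒x≡y v x∈⁅v⁆ = x∈p∩q⁺ (v∈R , from x∈N⁺[S]⇔ (inj₁ v∈S))
      ... | inj₂ x∈O∪X with x∈p∪q⁻ O X x∈O∪X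
      ...   | inj₁ x∈O = let _ , x∈R , vx = to (x∈outNbhd⇔ {R}) x∈O
                         in x∈p∩q⁺ (x∈R , from x∈N⁺[S]⇔ (inj₂ (v , v∈S , vx)))
      ...   | inj₂ x∈X = let x∈R′ , x∈N⁺[S′] = x∈p∩q⁻ R′ _ x∈X
                         in x∈p∩q⁺ (p─q⊆p R _ x∈R′ , N⁺-mono (q⊆p∪q ⁅ v ⁆ S′) x∈N⁺[S′])

    halfCover-step : ∀ {S′} → ∣ inNbhd R v ∣ ≤ℕ ∣ outNbhd R v ∣ →
      IndependentHalfCover R′ S′ → IndependentHalfCover R (⁅ v ⁆ ∪ S′)
    halfCover-step {S′} in≤out (S′⊆R′ , S′-ind , ∣R′∣≤2c′) = S⊆R , ⁅v⁆∪-independent S′⊆R′ S′-ind , ∣R∣≤2c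
      where
      open ℕ.≤-Reasoning
      S⊆R : ⁅ v ⁆ ∪ S′ ⊆ R
      S⊆R x∈S with x∈p∪q⁻ ⁅ v ⁆ S′ x∈S
      ... | inj₁ x∈⁅v⁆ rewrite x∈⁅y⁆⇒x≡y v x∈⁅v⁆ = v∈R
      ... | inj₂ x∈S′ = p─q⊆p R _ (S′⊆R′ x∈S′)
      ∣R∣≤2c : ∣ R ∣ ≤ℕ 2 ℕ.* ∣ R ∩ N⁺[ ⁅ v ⁆ ∪ S′ ] D ∣
      ∣R∣≤2c = begin
        ∣ R ∣
          ≤⟨ ∣p∣≤∣q∣+∣p─q∣ R (block R v) ⟩
        ∣ block R v ∣ + ∣ R′ ∣
          ≤⟨ ℕ.+-mono-≤ (∣block∣≤1+out+in R v) ∣R′∣≤2c′ ⟩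
        1 + (∣ outNbhd R v ∣ + ∣ inNbhd R v ∣) + 2 ℕ.* ∣ R′ ∩ N⁺[ S′ ] D ∣
          ≤⟨ 1+[o+i]+2x≤2[1+o+x] _ in≤out ⟩
        2 ℕ.* (1 + (∣ outNbhd R v ∣ + ∣ R′ ∩ N⁺[ S′ ] D ∣))
          ≤⟨ ℕ.*-monoʳ-≤ 2 (1+out+covered≤covered S′) ⟩
        2 ℕ.* ∣ R ∩ N⁺[ ⁅ v ⁆ ∪ S′ ] D ∣
          ∎

  halfCover : ∀ R → ∃[ S ] IndependentHalfCover R S
  halfCover = All.wfRec (On.wellFounded ∣_∣ <-wellFounded) _ HasHalfCover extend
    where
    HasHalfCover : Subset n → Set
    HasHalfCover R = ∃[ S ] IndependentHalfCover R S
    extend : ∀ R → (∀ {R′} → ∣ R′ ∣ <ℕ ∣ R ∣ → HasHalfCover R′) → HasHalfCover R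
    extend R rec with nonempty? R
    ... | no R=∅ = ∅ , ⊥⊆ , (λ a _ a∈∅ → ⊥-elim (∉⊥ a∈∅)) , ℕ.≤-trans ∣R∣≤0 ℕ.z≤n
      where
      ∣R∣≤0 : ∣ R ∣ ≤ℕ 0
      ∣R∣≤0 = ℕ.≤-reflexive (trans (cong ∣_∣ (Empty-unique R=∅)) (∣⊥∣≡0 n))
    ... | yes R≠∅ = let v , v∈R , in≤out = ∃in≤out R≠∅
                        S′ , cover′ = rec (p∩q≢∅⇒∣p─q∣<∣p∣ R (block R v) (v , x∈p∩q⁺ (v∈R , v∈block R v)))
                    in ⁅ v ⁆ ∪ S′ , halfCover-step v∈R in≤out cover′

  augment : Subset n → Subset n → Subset n
  augment Q S = S ∪ (Q ─ N⁺[ S ] D)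

  augment-is3Kernel : ∀ {Q S} → IsQuasikernel D Q → S ⊆ ∁ (N⁺[ Q ] D) → Independent D S →
    IsQKernel D 3 (augment Q S)
  augment-is3Kernel {Q} {S} (Q-ind , Q-dom) S∩N⁺[Q]=∅ S-ind = independent , dominating
    where
    independent : Independent D (augment Q S)
    independent a b a∈Q′ b∈Q′ ab with x∈p∪q⁻ S _ a∈Q′ | x∈p∪q⁻ S _ b∈Q′
    ... | inj₁ a∈S | inj₁ b∈S = S-ind a b a∈S b∈S ab
    ... | inj₁ a∈S | inj₂ b∈Q─N⁺[S] = x∈p─q⇒x∉q b∈Q─N⁺[S] (from x∈N⁺[S]⇔ (inj₂ (a , a∈S , ab)))
    ... | inj₂ a∈Q─N⁺[S] | inj₁ b∈S =
      x∈∁p⇒x∉p (S∩N⁺[Q]=∅ b∈S) (from x∈N⁺[S]⇔ (inj₂ (a , p─q⊆p Q _ a∈Q─N⁺[S] , ab)))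
    ... | inj₂ a∈Q─N⁺[S] | inj₂ b∈Q─N⁺[S] =
      Q-ind a b (p─q⊆p Q _ a∈Q─N⁺[S]) (p─q⊆p Q _ b∈Q─N⁺[S]) ab
    k≤2⇒k≤3 : ∀ {k} → k ≤ℕ 2 → k ≤ℕ 3
    k≤2⇒k≤3 k≤2 = ℕ.≤-trans k≤2 (ℕ.n≤1+n 2)
    dominating : ∀ v → DistLe D (augment Q S) v 3
    dominating v with Q-dom v
    ... | u , k , u∈Q , k≤2 , u⇝v with u ∈? N⁺[ S ] D
    ...   | no u∉N⁺[S] = u , k , x∈p∪q⁺ (inj₂ (x∈p∧x∉q⇒x∈p─q u∈Q u∉N⁺[S])) , k≤2⇒k≤3 k≤2 , u⇝v
    ...   | yes u∈N⁺[S] with to x∈N⁺[S]⇔ u∈N⁺[S]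
    ...     | inj₁ u∈S = u , k , x∈p∪q⁺ (inj₁ u∈S) , k≤2⇒k≤3 k≤2 , u⇝v
    ...     | inj₂ (t , t∈S , tu) = t , ℕ.suc k , x∈p∪q⁺ (inj₁ t∈S) , ℕ.s≤s k≤2 , step tu u⇝v

  ∣N⁺[Q]∣+2∣N⁺[augment]∣ : ∀ {Q S} → IndependentHalfCover (∁ (N⁺[ Q ] D)) S →
    n ≤ℕ ∣ N⁺[ Q ] D ∣ + 2 ℕ.* ∣ N⁺[ augment Q S ] D ∣
  ∣N⁺[Q]∣+2∣N⁺[augment]∣ {Q} {S} (_ , _ , ∣R∣≤2∣R∩N⁺[S]∣) = begin
    n
      ≡⟨ ∣p∣+∣∁p∣≡n (N⁺[ Q ] D) ⟨
    ∣ N⁺[ Q ] D ∣ + ∣ R ∣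
      ≤⟨ ℕ.+-monoʳ-≤ ∣ N⁺[ Q ] D ∣ ∣R∣≤2∣R∩N⁺[S]∣ ⟩
    ∣ N⁺[ Q ] D ∣ + 2 ℕ.* ∣ R ∩ N⁺[ S ] D ∣
      ≤⟨ ℕ.+-monoʳ-≤ ∣ N⁺[ Q ] D ∣ (ℕ.*-monoʳ-≤ 2 (p⊆q⇒∣p∣≤∣q∣ R∩N⁺[S]⊆N⁺[Q′])) ⟩
    ∣ N⁺[ Q ] D ∣ + 2 ℕ.* ∣ N⁺[ Q′ ] D ∣
      ∎
    where
    open ℕ.≤-Reasoning
    R = ∁ (N⁺[ Q ] D)
    Q′ = augment Q S
    R∩N⁺[S]⊆N⁺[Q′] : R ∩ N⁺[ S ] D ⊆ N⁺[ Q′ ] D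
    R∩N⁺[S]⊆N⁺[Q′] = N⁺-mono {S} {Q′} (p⊆p∪q _) ∘ proj₂ ∘ x∈p∩q⁻ R _

toℚ : ℕ → ℚ
toℚ k = + k / 1

toℚ≡mkℚ : ∀ k → toℚ k ≡ ℚ.mkℚ (+ k) 0 (Coprime.sym (1-coprimeTo k))
toℚ≡mkℚ k = ℚ.normalize-coprime (Coprime.sym (1-coprimeTo k))

toℚ-+ : ∀ a b → toℚ (a + b) ≡ toℚ a ℚ.+ toℚ b
toℚ-+ a b rewrite toℚ≡mkℚ a | toℚ≡mkℚ b | ℕ.*-identityʳ a | ℕ.*-identityʳ b | ℤ.+◃n≡+n a | ℤ.+◃n≡+n b = refl

toℚ-mono-≤ : ∀ {a b} → a ≤ℕ b → toℚ a ≤ toℚ b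
toℚ-mono-≤ {a} {b} a≤b rewrite toℚ≡mkℚ a | toℚ≡mkℚ b =
  ℚ.*≤* (subst₂ ℤ._≤_ (sym (ℤ.*-identityʳ (+ a))) (sym (ℤ.*-identityʳ (+ b))) (ℤ.+≤+ a≤b))

[1-ε]½n≤m : ∀ n c m ε → toℚ c ≡ ε * toℚ n → n ≤ℕ c + 2 ℕ.* m → ((1ℚ - ε) * ½) * toℚ n ≤ toℚ m
[1-ε]½n≤m n c m ε c≡εn n≤c+2m = begin
  ((1ℚ - ε) * ½) * toℚ n                    ≡⟨ expand ε ½ (toℚ n) ⟩
  ½ * (toℚ n - ε * toℚ n)                   ≡⟨ cong (λ z → ½ * (toℚ n - z)) c≡εn ⟨
  ½ * (toℚ n - toℚ c)                       ≤⟨ ℚ.*-monoˡ-≤-nonNeg ½ (ℚ.+-monoˡ-≤ (ℚ.- toℚ c) n≤c+[m+m]) ⟩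
  ½ * (toℚ c ℚ.+ (toℚ m ℚ.+ toℚ m) - toℚ c) ≡⟨ cancel (toℚ c) (toℚ m) ⟩
  toℚ m                                     ∎
  where
  open ℚ.≤-Reasoning
  open +-*-Solver
  expand : ∀ e h x → (1ℚ - e) * h * x ≡ h * (x - e * x)
  expand = solve 3 (λ e h x → (con 1ℚ :- e) :* h :* x := h :* (x :- e :* x)) refl
  cancel : ∀ y x → ½ * (y ℚ.+ (x ℚ.+ x) - y) ≡ x
  cancel = solve 2 (λ y x → con ½ :* (y :+ (x :+ x) :- y) := x) refl
  toℚ[c+2m] : toℚ (c + 2 ℕ.* m) ≡ toℚ c ℚ.+ (toℚ m ℚ.+ toℚ m)
  toℚ[c+2m] = begin-equality
    toℚ (c + 2 ℕ.* m)            ≡⟨ toℚ-+ c (2 ℕ.* m) ⟩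
    toℚ c ℚ.+ toℚ (m + (m + 0))  ≡⟨ cong (λ k → toℚ c ℚ.+ toℚ (m + k)) (ℕ.+-identityʳ m) ⟩
    toℚ c ℚ.+ toℚ (m + m)        ≡⟨ cong (toℚ c ℚ.+_) (toℚ-+ m m) ⟩
    toℚ c ℚ.+ (toℚ m ℚ.+ toℚ m)  ∎
  n≤c+[m+m] : toℚ n ≤ toℚ c ℚ.+ (toℚ m ℚ.+ toℚ m)
  n≤c+[m+m] = subst (toℚ n ≤_) toℚ[c+2m] (toℚ-mono-≤ n≤c+2m)

proposition4p2 : (n : ℕ) (D : Digraph n) (Q : Subset n) → IsQuasikernel D Q →
    (ε : ℚ) → 0ℚ < ε → ε < 1ℚ →
    (+ ∣ N⁺[ Q ] D ∣ / 1) ≡ ε * (+ n / 1) →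
    ∃[ Q′ ] (IsQKernel D 3 Q′ × ((1ℚ - ε) * ½) * (+ n / 1) ≤ (+ ∣ N⁺[ Q′ ] D ∣ / 1))
proposition4p2 n D Q Q-quasi ε _ _ ∣N⁺[Q]∣≡εn with halfCover D (∁ (N⁺[ Q ] D))
... | S , cover@(S⊆R , S-ind , _) =
  augment D Q S ,
  augment-is3Kernel D Q-quasi S⊆R S-ind ,
  [1-ε]½n≤m n ∣ N⁺[ Q ] D ∣ ∣ N⁺[ augment D Q S ] D ∣ ε ∣N⁺[Q]∣≡εn (∣N⁺[Q]∣+2∣N⁺[augment]∣ D {Q} cover)
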